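{- Let $X$ be a set and $R\subseteq X\times X$ be co-confluent. Then the protection relation $\sqsupset_R$ induced by $R$ is consistent if and only if $R$ is irreflexive.
   Context: $R$ is co-confluent iff $\forall x,y,z,w\in X\,\big((xRy \wedge zRx \wedge wRy)\Rightarrow zRw\big)$. $R$ is irreflexive iff $\forall x\in X.\ \neg xRx$. The protection relation induced by $R$ is defined by $x \sqsupset_R z$ iff $\forall y\in X\,(yRz \Rightarrow xRy)$. $\sqsupset_R$ is consistent iff $\forall x,y\in X\,(x\sqsupset_R y \Rightarrow \neg xRy)$. -}

module Defs where

open import Level using (Level; _⊔_)
open import Relation.Binary.Core using (Rel)
open import Relation.Nullary using (¬_)
open import Data.Product using (_×_)

private
  variable
    a ℓ : Level

CoConfluent : {X : Set a} → Rel X ℓ → Set (a ⊔ ℓ)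
CoConfluent {X = X} R = ∀ (x y z w : X) → R x y × R z x × R w y → R z w

Irreflexive : {X : Set a} → Rel X ℓ → Set (a ⊔ ℓ)
Irreflexive {X = X} R = ∀ (x : X) → ¬ R x x

Protects : {X : Set a} → Rel X ℓ → Rel X (a ⊔ ℓ)
Protects {X = X} R x z = ∀ (y : X) → R y z → R x y

ConsistentProtection : {X : Set a} → Rel X ℓ → Set (a ⊔ ℓ)
ConsistentProtection {X = X} R = ∀ (x y : X) → Protects R x y → ¬ R x y

module Submission where

open import Defs
open import Level using (Level)
open import Relation.Binary.Core using (Rel)
open import Function.Bundles using (_⇔_; mk⇔)
open import Data.Product using (_,_)

reflexive⇒protects-self : {a ℓ : Level} {X : Set a} (R : Rel X ℓ) →
  CoConfluent R → ∀ x → R x x → Protects R x x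
reflexive⇒protects-self R cc x rxx y ryx = cc x x x y (rxx , rxx , ryx)

consistent⇒irreflexive : {a ℓ : Level} {X : Set a} (R : Rel X ℓ) →
  CoConfluent R → ConsistentProtection R → Irreflexive R
consistent⇒irreflexive R cc cons x rxx =
  cons x x (reflexive⇒protects-self R cc x rxx) rxx

-- Protection of y applied to the attacker x itself yields x R x.
irreflexive⇒consistent : {a ℓ : Level} {X : Set a} (R : Rel X ℓ) →
  Irreflexive R → ConsistentProtection R
irreflexive⇒consistent R irr x y x⊐y rxy = irr x (x⊐y x rxy)

mainTheorem4 : {a ℓ : Level} {X : Set a} (R : Rel X ℓ) →
    CoConfluent R → (ConsistentProtection R ⇔ Irreflexive R)
mainTheorem4 R cc =
  mk⇔ (consistent⇒irreflexive R cc) (irreflexive⇒consistent R)
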